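{- Let $M$ be a matroid with ground set $E$. Then \[ Z_M(q,T) = q^{ -1}(q-1) \left( \frac{1}{1 - q^{ -\operatorname{rk} M}T^{\# E}} \right) \overline{Z}_M(q,T), \] and \[ Z_M^0(q,T) = q^{ -1} (q-1) \left( \frac{q^{ -\operatorname{rk} M} T^{\# E}}{1-q^{ -\operatorname{rk} M}T^{\# E}} \right) \overline{Z}_M(q,T). \]
   Context: Let $M$ be a matroid on ground set $E$ with rank function $\operatorname{rk}$, characteristic polynomial $\chi$ and reduced characteristic polynomial $\overline{\chi}=\chi/(q-1)$. For $w\in\mathbb{R}^E$: $\operatorname{wt}_M(w)=\max_{B\text{ basis}}\sum_{e\in B}w_e$, $M_w$ is the matroid on $E$ whose bases are the bases attaining this maximum, $|w|=\sum_ew_e$. For $v\in\mathbb{R}^E/\mathbb{R}\mathbf{1}$ with lift $w$: $\overline{\operatorname{wt}}_M(v)=\operatorname{wt}_M(w)-(\operatorname{rk}M)\min(w)$, $\overline{|v|}=|w|-(\#E)\min(w)$, $M_v=M_w$. Define $Z_M(q,T)=\sum_{w\in\mathbb{Z}_{\ge0}^E}\chi_{M_w}(q)q^{ -\operatorname{rk}M-\operatorname{wt}_M(w)}T^{|w|}$, $Z_M^0(q,T)$ the same sum over $w\in\mathbb{Z}_{>0}^E$, and $\overline{Z}_M(q,T)=\sum_{v\in\mathbb{Z}^E/\mathbb{Z}\mathbf{1}}\overline{\chi}_{M_v}(q)q^{ -(\operatorname{rk}M-1)-\overline{\operatorname{wt}}_M(v)}T^{\overline{|v|}}$. -}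

module Defs where

open import Data.Nat as ℕ using (ℕ; zero; suc; _⊔_)
open import Data.Vec.Relation.Unary.All using () renaming (all? to allV?)
open import Data.Integer as ℤ using (ℤ; +_; -[1+_])
open import Data.Rational using (ℚ; 0ℚ; 1ℚ; _+_; _*_; _-_; -_; 1/_; _÷_; NonZero)
open import Data.Bool using (Bool; true; false; if_then_else_)
open import Data.Fin using (Fin)
open import Data.Fin.Subset using (Subset; inside; outside; _∈_; _∉_; _∩_; _∪_; ⁅_⁆; ∣_∣; ⊤) renaming (_-_ to _∖ₛ_)
open import Data.Vec as Vec using (Vec; []; _∷_)
open import Data.List as List using (List; []; _∷_; _++_; map; filter; concatMap)
open import Data.Product using (Σ; ∃; _×_; _,_)
open import Relation.Nullary using (Dec; yes; no; ¬_)
open import Relation.Nullary.Decidable using (⌊_⌋)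
open import Relation.Unary using (Decidable)
open import Relation.Binary.PropositionalEquality using (_≡_)

record Matroid (n : ℕ) : Set₁ where
  field
    Basis     : Subset n → Set
    basis?    : Decidable Basis
    nonempty  : ∃ Basis
    exchange  : ∀ {B₁ B₂} → Basis B₁ → Basis B₂ →
                ∀ {x} → x ∈ B₁ → x ∉ B₂ →
                ∃ λ y → y ∈ B₂ × y ∉ B₁ × Basis ((B₁ ∖ₛ x) ∪ ⁅ y ⁆)

allSubsets : (n : ℕ) → List (Subset n)
allSubsets zero    = [] ∷ []
allSubsets (suc n) = map (inside ∷_) (allSubsets n) ++ map (outside ∷_) (allSubsets n)

vecsWithSum : (n k : ℕ) → List (Vec ℕ n)
vecsWithSum zero    zero    = [] ∷ []
vecsWithSum zero    (suc k) = []
vecsWithSum (suc n) k       = concatMap (λ i → map (i ∷_) (vecsWithSum n (k ℕ.∸ i))) (List.upTo (suc k))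

sumℚ : List ℚ → ℚ
sumℚ = List.foldr _+_ 0ℚ

maxℕ : List ℕ → ℕ
maxℕ = List.foldr _⊔_ 0

pow : ℚ → ℕ → ℚ
pow a zero    = 1ℚ
pow a (suc m) = a * pow a m

powℤ : (q : ℚ) → .{{_ : NonZero q}} → ℤ → ℚ
powℤ q (+ m)      = pow q m
powℤ q -[1+ m ]   = pow (1/ q) (suc m)

weight : ∀ {n} → Subset n → Vec ℕ n → ℕ
weight []            []       = 0
weight (inside ∷ B)  (x ∷ w)  = x ℕ.+ weight B w
weight (outside ∷ B) (x ∷ w)  = weight B w

size : ∀ {n} → Vec ℕ n → ℕ
size = Vec.sum

-- min(w) (with min of the empty vector taken to be 0)
minV : ∀ {n} → Vec ℕ n → ℕ
minV []            = 0
minV (x ∷ [])      = x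
minV (x ∷ y ∷ w)   = x ℕ.⊓ minV (y ∷ w)

module _ {n : ℕ} (M : Matroid n) where
  open Matroid M

  bases : List (Subset n)
  bases = filter basis? (allSubsets n)

  rankOf : List (Subset n) → Subset n → ℕ
  rankOf L A = maxℕ (map (λ B → ∣ A ∩ B ∣) L)

  rk : ℕ
  rk = rankOf bases ⊤

  wt : Vec ℕ n → ℕ
  wt w = maxℕ (map (λ B → weight B w) bases)

  -- bases of M_w: the bases attaining the maximum wt_M(w)
  basesAt : Vec ℕ n → List (Subset n)
  basesAt w = filter (λ B → weight B w ℕ.≟ wt w) bases

χ : ∀ {n} (M : Matroid n) → List (Subset n) → ℚ → ℚ
χ {n} M L q = sumℚ (map (λ A → pow (- 1ℚ) ∣ A ∣ * pow q (rankOf M L ⊤ ℕ.∸ rankOf M L A)) (allSubsets n))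

χbar : ∀ {n} (M : Matroid n) → List (Subset n) → (q : ℚ) → .{{_ : NonZero (q - 1ℚ)}} → ℚ
χbar M L q = χ M L q ÷ (q - 1ℚ)

-- Formal power series in T with rational coefficients: k ↦ [T^k]

Series : Set
Series = ℕ → ℚ

_⊛_ : Series → Series → Series
(f ⊛ g) k = sumℚ (map (λ i → f i * g (k ℕ.∸ i)) (List.upTo (suc k)))

_·ₛ_ : ℚ → Series → Series
(c ·ₛ f) k = c * f k

mono : ℚ → ℕ → Series
mono a m k with k ℕ.≟ m
... | yes _ = a
... | no  _ = 0ℚ

-- 1 / (1 - a T^m) = Σ_{j ≥ 0} a^j T^{m j}   (m ≥ 1; only j ≤ k contribute to [T^k])
geom : ℚ → ℕ → Series
geom a m k = sumℚ (map (λ j → mono (pow a j) (m ℕ.* j) k) (List.upTo (suc k)))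

module _ {n : ℕ} (M : Matroid n) (q : ℚ) .{{_ : NonZero q}} where

  Zterm : Vec ℕ n → ℚ
  Zterm w = χ M (basesAt M w) q * pow (1/ q) (rk M ℕ.+ wt M w)

  Z : Series
  Z k = sumℚ (map Zterm (vecsWithSum n k))

  Z⁰ : Series
  Z⁰ k = sumℚ (map Zterm (filter (λ w → allV? (λ x → 1 ℕ.≤? x) w) (vecsWithSum n k)))

  wtbar : Vec ℕ n → ℤ
  wtbar w = + wt M w ℤ.- + (rk M ℕ.* minV w)

  sizebar : Vec ℕ n → ℕ
  sizebar w = size w ℕ.∸ n ℕ.* minV w

  -- Z‾_M(q,T) = Σ_{v ∈ ℤ^E/ℤ1} χ‾_{M_v}(q) q^{-(rk M - 1) - wt‾_M(v)} T^{|v|‾};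
  -- each class v is represented by its unique lift w ∈ ℤ_{≥0}^E with min(w) = 0.
  Zbar : .{{_ : NonZero (q - 1ℚ)}} → Series
  Zbar k = sumℚ (map (λ w → χbar M (basesAt M w) q
                              * powℤ q (ℤ.- (+ rk M ℤ.- ℤ.+ 1) ℤ.- wtbar w))
                 (filter (λ w → sizebar w ℕ.≟ k)
                   (filter (λ w → minV w ℕ.≟ 0) (vecsWithSum n k))))

-- Every basis has rk M elements, so adding 1 to all coordinates of w raises wt_M(w) by rk M and
-- leaves M_w unchanged; hence the positive w contribute Z⁰_M = q^{-rk M} T^{#E} Z_M.  The other w,
-- those with min(w) = 0, are the representatives of ℤ^E/ℤ1 used by Z‾_M and contribute
-- q^{-1}(q-1) Z‾_M.  So (1 - q^{-rk M} T^{#E}) Z_M = q^{-1}(q-1) Z‾_M, and both formulas follow by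
-- multiplying with the geometric series.

module Submission where

open import Defs
open import Data.Nat as ℕ using (ℕ; zero; suc; _≤_; _<_; _≤?_; _≟_; _⊔_; z≤n; s≤s; _∸_)
import Data.Nat.Properties as ℕP
open import Data.Nat.Induction using (<-rec; <-wellFounded)
open import Induction.WellFounded using (Acc; acc)
open import Data.Integer as ℤ using (1ℤ; 0ℤ)
open import Data.Integer.Tactic.RingSolver using (solve-∀)
open import Data.Rational as ℚ using (ℚ; 0ℚ; 1ℚ; _*_; _+_; _-_; 1/_; _÷_)
import Data.Rational.Properties as ℚP
open import Data.Rational.Solver using (module +-*-Solver)
open import Algebra.Bundles using (CommutativeRing)
open import Algebra.Properties.CommutativeSemigroup (CommutativeRing.*-commutativeSemigroup ℚP.+-*-commutativeRing)
  using () renaming (x∙yz≈y∙xz to x*yz≡y*xz)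
open import Algebra.Properties.CommutativeSemigroup (CommutativeRing.+-commutativeSemigroup ℚP.+-*-commutativeRing)
  using () renaming (x∙yz≈y∙xz to x+yz≡y+xz; interchange to +-interchange)
open import Data.List as List using (List; []; _∷_; _++_; map; filter; concatMap; applyUpTo)
import Data.List.Properties as List
open import Data.Product using (∃; _×_; _,_; proj₂)
open import Data.Fin using () renaming (zero to fzero; suc to fsuc)
open import Data.Fin.Subset using (Subset; inside; outside; _∈_; _∉_; _∪_; _─_; ⁅_⁆; ∣_∣) renaming (_-_ to _∖_)
open import Data.Fin.Subset.Properties
  using ( ∪-identityʳ; ∩-identityˡ; p─⊥≡p; p─q⊆p; p─q─r≡p─r─q; x∈p∧x∉q⇒x∈p─q; x∈p⇒∣p-x∣<∣p∣
        ; p⊆q⇒∣p∣≤∣q∣; nonempty?; _∈?_)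
open import Data.List.Relation.Unary.All as All using (All; []; _∷_)
open import Data.List.Relation.Unary.All.Properties using (all-filter; filter⁺; concat⁺; map⁺; applyUpTo⁺₁)
open import Data.List.Relation.Unary.Any using () renaming (here to hereₗ)
open import Data.List.Membership.Propositional using () renaming (_∈_ to _∈ₗ_)
open import Data.List.Membership.Propositional.Properties using (∈-filter⁺; ∈-map⁺; ∈-++⁺ˡ; ∈-++⁺ʳ)
open import Data.Vec as Vec using (Vec; []; _∷_; here; there)
open import Data.Vec.Relation.Unary.All using ([]; _∷_) renaming (All to AllV; all? to allV?)
open import Function.Bundles using (_⇔_; mk⇔; Equivalence)
open import Function using (_∘_; id)
open import Data.Bool using (true; false; if_then_else_)
open import Relation.Nullary using (does; yes; no; contradiction)
open import Relation.Nullary.Decidable using (decidable-stable)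
open import Relation.Unary using (Decidable; _≐_; ∁)
open import Relation.Unary.Properties using (∁?)
open import Relation.Binary.PropositionalEquality
open ≡-Reasoning

sumBelow : ℕ → (ℕ → ℚ) → ℚ
sumBelow zero    f = 0ℚ
sumBelow (suc K) f = f 0 + sumBelow K (f ∘ suc)

sumℚ-map-applyUpTo : ∀ (f : ℕ → ℚ) g K → sumℚ (map f (applyUpTo g K)) ≡ sumBelow K (f ∘ g)
sumℚ-map-applyUpTo f g zero    = refl
sumℚ-map-applyUpTo f g (suc K) = cong (f (g 0) +_) (sumℚ-map-applyUpTo f (g ∘ suc) K)

sumℚ-map-upTo : ∀ (f : ℕ → ℚ) K → sumℚ (map f (List.upTo K)) ≡ sumBelow K f
sumℚ-map-upTo f = sumℚ-map-applyUpTo f id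

sumBelow-cong : ∀ K {f g : ℕ → ℚ} → (∀ {i} → i < K → f i ≡ g i) → sumBelow K f ≡ sumBelow K g
sumBelow-cong zero    eq = refl
sumBelow-cong (suc K) eq = cong₂ _+_ (eq (s≤s z≤n)) (sumBelow-cong K (eq ∘ s≤s))

sumBelow-zero : ∀ K {f : ℕ → ℚ} → (∀ {i} → i < K → f i ≡ 0ℚ) → sumBelow K f ≡ 0ℚ
sumBelow-zero zero    eq = refl
sumBelow-zero (suc K) eq = begin
  _            ≡⟨ cong₂ _+_ (eq (s≤s z≤n)) (sumBelow-zero K (eq ∘ s≤s)) ⟩
  0ℚ + 0ℚ      ≡⟨ ℚP.+-identityˡ 0ℚ ⟩
  0ℚ           ∎

sumBelow-+ : ∀ m K (f : ℕ → ℚ) → sumBelow (m ℕ.+ K) f ≡ sumBelow m f + sumBelow K (λ i → f (m ℕ.+ i))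
sumBelow-+ zero    K f = sym (ℚP.+-identityˡ _)
sumBelow-+ (suc m) K f = trans (cong (f 0 +_) (sumBelow-+ m K (f ∘ suc))) (sym (ℚP.+-assoc (f 0) _ _))

sumBelow-last : ∀ K (f : ℕ → ℚ) → sumBelow (suc K) f ≡ sumBelow K f + f K
sumBelow-last K f = begin
  sumBelow (suc K) f                 ≡⟨ cong (λ N → sumBelow N f) (ℕP.+-comm 1 K) ⟩
  sumBelow (K ℕ.+ 1) f               ≡⟨ sumBelow-+ K 1 f ⟩
  sumBelow K f + (f (K ℕ.+ 0) + 0ℚ)  ≡⟨ cong (sumBelow K f +_) (trans (ℚP.+-identityʳ _) (cong f (ℕP.+-identityʳ K))) ⟩
  sumBelow K f + f K                 ∎

*-distribˡ-sumBelow : ∀ c K (f : ℕ → ℚ) → c * sumBelow K f ≡ sumBelow K (λ i → c * f i)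
*-distribˡ-sumBelow c zero    f = ℚP.*-zeroʳ c
*-distribˡ-sumBelow c (suc K) f =
  trans (ℚP.*-distribˡ-+ c (f 0) _) (cong (c * f 0 +_) (*-distribˡ-sumBelow c K (f ∘ suc)))

sumBelow-+-distrib : ∀ K (f g : ℕ → ℚ) → sumBelow K (λ i → f i + g i) ≡ sumBelow K f + sumBelow K g
sumBelow-+-distrib zero    f g = refl
sumBelow-+-distrib (suc K) f g = begin
  (f 0 + g 0) + sumBelow K (λ i → f (suc i) + g (suc i))
    ≡⟨ cong ((f 0 + g 0) +_) (sumBelow-+-distrib K (f ∘ suc) (g ∘ suc)) ⟩
  (f 0 + g 0) + (sumBelow K (f ∘ suc) + sumBelow K (g ∘ suc))
    ≡⟨ +-interchange (f 0) (g 0) (sumBelow K (f ∘ suc)) (sumBelow K (g ∘ suc)) ⟩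
  (f 0 + sumBelow K (f ∘ suc)) + (g 0 + sumBelow K (g ∘ suc)) ∎

sumℚ-++ : ∀ (xs ys : List ℚ) → sumℚ (xs ++ ys) ≡ sumℚ xs + sumℚ ys
sumℚ-++ []       ys = sym (ℚP.+-identityˡ _)
sumℚ-++ (x ∷ xs) ys = trans (cong (x +_) (sumℚ-++ xs ys)) (sym (ℚP.+-assoc x _ _))

sumℚ-concatMap : ∀ {A B : Set} (f : B → ℚ) (g : A → List B) xs →
                 sumℚ (map f (concatMap g xs)) ≡ sumℚ (map (λ x → sumℚ (map f (g x))) xs)
sumℚ-concatMap f g []       = refl
sumℚ-concatMap f g (x ∷ xs) = begin
  sumℚ (map f (g x ++ concatMap g xs))                 ≡⟨ cong sumℚ (List.map-++ f (g x) _) ⟩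
  sumℚ (map f (g x) ++ map f (concatMap g xs))         ≡⟨ sumℚ-++ (map f (g x)) _ ⟩
  sumℚ (map f (g x)) + sumℚ (map f (concatMap g xs))   ≡⟨ cong (sumℚ (map f (g x)) +_) (sumℚ-concatMap f g xs) ⟩
  _                                                    ∎

*-distribˡ-sumℚ : ∀ {A : Set} c (f : A → ℚ) xs → c * sumℚ (map f xs) ≡ sumℚ (map (λ x → c * f x) xs)
*-distribˡ-sumℚ c f []       = ℚP.*-zeroʳ c
*-distribˡ-sumℚ c f (x ∷ xs) = trans (ℚP.*-distribˡ-+ c (f x) _) (cong (c * f x +_) (*-distribˡ-sumℚ c f xs))

sumℚ-zeros : ∀ {A : Set} (xs : List A) → sumℚ (map (λ _ → 0ℚ) xs) ≡ 0ℚ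
sumℚ-zeros []       = refl
sumℚ-zeros (x ∷ xs) = trans (cong (0ℚ +_) (sumℚ-zeros xs)) (ℚP.+-identityˡ 0ℚ)

sumℚ-filter : ∀ {A : Set} {P : A → Set} (P? : Decidable P) (f : A → ℚ) xs →
              sumℚ (map f (filter P? xs)) ≡ sumℚ (map (λ x → if does (P? x) then f x else 0ℚ) xs)
sumℚ-filter P? f []       = refl
sumℚ-filter P? f (x ∷ xs) with does (P? x)
... | true  = cong (f x +_) (sumℚ-filter P? f xs)
... | false = trans (sumℚ-filter P? f xs) (sym (ℚP.+-identityˡ _))

sumℚ-filter-partition : ∀ {A : Set} {P : A → Set} (P? : Decidable P) (f : A → ℚ) xs →
  sumℚ (map f (filter P? xs)) + sumℚ (map f (filter (∁? P?) xs)) ≡ sumℚ (map f xs)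
sumℚ-filter-partition P? f []       = ℚP.+-identityˡ 0ℚ
sumℚ-filter-partition P? f (x ∷ xs) with P? x
... | yes _ = trans (ℚP.+-assoc (f x) _ _) (cong (f x +_) (sumℚ-filter-partition P? f xs))
... | no  _ = trans (x+yz≡y+xz (sumℚ (map f (filter P? xs))) (f x) _)
                    (cong (f x +_) (sumℚ-filter-partition P? f xs))

filter-cong-local : ∀ {A : Set} {P Q : A → Set} (P? : Decidable P) (Q? : Decidable Q) {xs : List A} →
                    All (λ x → P x ⇔ Q x) xs → filter P? xs ≡ filter Q? xs
filter-cong-local P? Q? []                        = refl
filter-cong-local P? Q? {x ∷ xs} (P⇔Q ∷ P⇔Qs) with P? x | Q? x
... | yes _  | yes _  = cong (x ∷_) (filter-cong-local P? Q? P⇔Qs)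
... | no  _  | no  _  = filter-cong-local P? Q? P⇔Qs
... | yes px | no ¬qx = contradiction (Equivalence.to P⇔Q px) ¬qx
... | no ¬px | yes qx = contradiction (Equivalence.from P⇔Q qx) ¬px

maxℕ-map-const : ∀ {A : Set} {f : A → ℕ} {c x} {xs : List A} → x ∈ₗ xs → All (λ y → f y ≡ c) xs →
                 maxℕ (map f xs) ≡ c
maxℕ-map-const {f = f} {xs = y ∷ []}     _ (fy≡c ∷ []) = trans (ℕP.⊔-identityʳ (f y)) fy≡c
maxℕ-map-const {c = c} {xs = y ∷ z ∷ xs} _ (fy≡c ∷ rest) =
  trans (cong₂ _⊔_ fy≡c (maxℕ-map-const (hereₗ refl) rest)) (ℕP.⊔-idem c)

maxℕ-map-+ : ∀ {A : Set} (f : A → ℕ) c {x} {xs : List A} → x ∈ₗ xs →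
             maxℕ (map (λ y → f y ℕ.+ c) xs) ≡ maxℕ (map f xs) ℕ.+ c
maxℕ-map-+ f c {xs = y ∷ []}     _ = trans (ℕP.⊔-identityʳ (f y ℕ.+ c)) (cong (ℕ._+ c) (sym (ℕP.⊔-identityʳ (f y))))
maxℕ-map-+ f c {xs = y ∷ z ∷ xs} _ =
  trans (cong (f y ℕ.+ c ⊔_) (maxℕ-map-+ f c {xs = z ∷ xs} (hereₗ refl))) (sym (ℕP.+-distribʳ-⊔ c (f y) _))

⊛-sumBelow : ∀ (f g : Series) k → (f ⊛ g) k ≡ sumBelow (suc k) (λ i → f i * g (k ∸ i))
⊛-sumBelow f g k = sumℚ-map-upTo (λ i → f i * g (k ∸ i)) (suc k)

⊛-congˡ : ∀ {f f' : Series} (g : Series) → (∀ i → f i ≡ f' i) → ∀ k → (f ⊛ g) k ≡ (f' ⊛ g) k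
⊛-congˡ g eq k = cong sumℚ (List.map-cong (λ i → cong (_* g (k ∸ i)) (eq i)) (List.upTo (suc k)))

⊛-·ₛˡ : ∀ c (f g : Series) k → ((c ·ₛ f) ⊛ g) k ≡ c * (f ⊛ g) k
⊛-·ₛˡ c f g k = begin
  sumℚ (map (λ i → c * f i * g (k ∸ i)) (List.upTo (suc k)))
    ≡⟨ cong sumℚ (List.map-cong (λ i → ℚP.*-assoc c (f i) (g (k ∸ i))) (List.upTo (suc k))) ⟩
  sumℚ (map (λ i → c * (f i * g (k ∸ i))) (List.upTo (suc k)))
    ≡⟨ *-distribˡ-sumℚ c (λ i → f i * g (k ∸ i)) (List.upTo (suc k)) ⟨
  c * (f ⊛ g) k ∎

⊛-·ₛʳ : ∀ c (f g : Series) k → (f ⊛ (c ·ₛ g)) k ≡ c * (f ⊛ g) k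
⊛-·ₛʳ c f g k = begin
  sumℚ (map (λ i → f i * (c * g (k ∸ i))) (List.upTo (suc k)))
    ≡⟨ cong sumℚ (List.map-cong (λ i → x*yz≡y*xz (f i) c (g (k ∸ i))) (List.upTo (suc k))) ⟩
  sumℚ (map (λ i → c * (f i * g (k ∸ i))) (List.upTo (suc k)))
    ≡⟨ *-distribˡ-sumℚ c (λ i → f i * g (k ∸ i)) (List.upTo (suc k)) ⟨
  c * (f ⊛ g) k ∎

⊛-distribʳ-+ : ∀ (f f' g : Series) k → ((λ i → f i + f' i) ⊛ g) k ≡ (f ⊛ g) k + (f' ⊛ g) k
⊛-distribʳ-+ f f' g k = begin
  ((λ i → f i + f' i) ⊛ g) k
    ≡⟨ ⊛-sumBelow (λ i → f i + f' i) g k ⟩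
  sumBelow (suc k) (λ i → (f i + f' i) * g (k ∸ i))
    ≡⟨ sumBelow-cong (suc k) (λ {i} _ → ℚP.*-distribʳ-+ (g (k ∸ i)) (f i) (f' i)) ⟩
  sumBelow (suc k) (λ i → f i * g (k ∸ i) + f' i * g (k ∸ i))
    ≡⟨ sumBelow-+-distrib (suc k) (λ i → f i * g (k ∸ i)) (λ i → f' i * g (k ∸ i)) ⟩
  sumBelow (suc k) (λ i → f i * g (k ∸ i)) + sumBelow (suc k) (λ i → f' i * g (k ∸ i))
    ≡⟨ cong₂ _+_ (⊛-sumBelow f g k) (⊛-sumBelow f' g k) ⟨
  (f ⊛ g) k + (f' ⊛ g) k ∎

⊛-zero : ∀ (f g : Series) → f 0 ≡ 0ℚ → (f ⊛ g) 0 ≡ 0ℚ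
⊛-zero f g f0 = begin
  _                 ≡⟨ cong (λ x → x * g 0 + 0ℚ) f0 ⟩
  0ℚ * g 0 + 0ℚ     ≡⟨ ℚP.+-identityʳ _ ⟩
  0ℚ * g 0          ≡⟨ ℚP.*-zeroˡ (g 0) ⟩
  0ℚ                ∎

⊛-suc : ∀ (f g : Series) → f 0 ≡ 0ℚ → ∀ k → (f ⊛ g) (suc k) ≡ ((f ∘ suc) ⊛ g) k
⊛-suc f g f0 k = begin
  (f ⊛ g) (suc k)                        ≡⟨ ⊛-sumBelow f g (suc k) ⟩
  f 0 * g (suc k) + rest                 ≡⟨ cong (λ x → x * g (suc k) + rest) f0 ⟩
  0ℚ * g (suc k) + rest                  ≡⟨ cong (_+ rest) (ℚP.*-zeroˡ (g (suc k))) ⟩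
  0ℚ + rest                              ≡⟨ ℚP.+-identityˡ rest ⟩
  rest                                   ≡⟨ ⊛-sumBelow (f ∘ suc) g k ⟨
  ((f ∘ suc) ⊛ g) k                      ∎
  where
  rest : ℚ
  rest = sumBelow (suc k) (λ i → f (suc i) * g (k ∸ i))

shift : ℕ → Series → Series
shift zero    f k       = f k
shift (suc m) f zero    = 0ℚ
shift (suc m) f (suc k) = shift m f k

shift-+ : ∀ m (f : Series) i → shift m f (m ℕ.+ i) ≡ f i
shift-+ zero    f i = refl
shift-+ (suc m) f i = shift-+ m f i

shift-< : ∀ {m k} (f : Series) → k < m → shift m f k ≡ 0ℚ
shift-< {suc m} {zero}  f _         = refl
shift-< {suc m} {suc k} f (s≤s k<m) = shift-< f k<m

shift-cong-≤ : ∀ m {k} {f g : Series} → (∀ {j} → j ≤ k → f j ≡ g j) → shift m f k ≡ shift m g k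
shift-cong-≤ zero              eq = eq ℕP.≤-refl
shift-cong-≤ (suc m) {zero}    eq = refl
shift-cong-≤ (suc m) {suc k}   eq = shift-cong-≤ m (eq ∘ ℕP.m≤n⇒m≤1+n)

shift-cong : ∀ m {f g : Series} → (∀ j → f j ≡ g j) → ∀ k → shift m f k ≡ shift m g k
shift-cong m eq k = shift-cong-≤ m (λ {j} _ → eq j)

shift-suc-cong-< : ∀ m {k} {f g : Series} → (∀ {j} → j < k → f j ≡ g j) → shift (suc m) f k ≡ shift (suc m) g k
shift-suc-cong-< m {zero}  eq = refl
shift-suc-cong-< m {suc k} eq = shift-cong-≤ m (eq ∘ s≤s)

shift-·ₛ : ∀ m c (f : Series) k → shift m (c ·ₛ f) k ≡ c * shift m f k
shift-·ₛ zero    c f k       = refl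
shift-·ₛ (suc m) c f zero    = sym (ℚP.*-zeroʳ c)
shift-·ₛ (suc m) c f (suc k) = shift-·ₛ m c f k

shift-⊛ : ∀ m (f g : Series) k → (shift m f ⊛ g) k ≡ shift m (f ⊛ g) k
shift-⊛ zero    f g k       = refl
shift-⊛ (suc m) f g zero    = ⊛-zero (shift (suc m) f) g refl
shift-⊛ (suc m) f g (suc k) = trans (⊛-suc (shift (suc m) f) g refl k) (shift-⊛ m f g k)

sumBelow-shift : ∀ m K (F : ℕ → Series) →
  sumBelow (suc K) (λ i → shift m (F i) (K ∸ i)) ≡ shift m (λ j → sumBelow (suc j) (λ i → F i (j ∸ i))) K
sumBelow-shift zero    K       F = refl
sumBelow-shift (suc m) zero    F = ℚP.+-identityˡ 0ℚ
sumBelow-shift (suc m) (suc K) F = begin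
  sumBelow (suc (suc K)) (λ i → shift (suc m) (F i) (suc K ∸ i))
    ≡⟨ sumBelow-last (suc K) (λ i → shift (suc m) (F i) (suc K ∸ i)) ⟩
  sumBelow (suc K) (λ i → shift (suc m) (F i) (suc K ∸ i)) + shift (suc m) (F (suc K)) (K ∸ K)
    ≡⟨ cong₂ _+_ (sumBelow-cong (suc K) λ {i} i≤K → cong (shift (suc m) (F i)) (ℕP.+-∸-assoc 1 (ℕP.≤-pred i≤K)))
                 (cong (shift (suc m) (F (suc K))) (ℕP.n∸n≡0 K)) ⟩
  sumBelow (suc K) (λ i → shift m (F i) (K ∸ i)) + 0ℚ
    ≡⟨ ℚP.+-identityʳ _ ⟩
  sumBelow (suc K) (λ i → shift m (F i) (K ∸ i))
    ≡⟨ sumBelow-shift m K F ⟩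
  shift m (λ j → sumBelow (suc j) (λ i → F i (j ∸ i))) K ∎

mono-self : ∀ x m → mono x m m ≡ x
mono-self x m with m ≟ m
... | yes _   = refl
... | no  m≢m = contradiction refl m≢m

mono-≢ : ∀ x {m k} → k ≢ m → mono x m k ≡ 0ℚ
mono-≢ x {m} {k} k≢m with k ≟ m
... | yes k≡m = contradiction k≡m k≢m
... | no  _   = refl

mono-suc : ∀ x m k → mono x (suc m) (suc k) ≡ mono x m k
mono-suc x m k with k ≟ m
... | yes refl = mono-self x (suc m)
... | no  k≢m  = mono-≢ x (k≢m ∘ ℕP.suc-injective)

mono-+ : ∀ x m p i → mono x (m ℕ.+ p) (m ℕ.+ i) ≡ mono x p i
mono-+ x zero    p i = refl
mono-+ x (suc m) p i = trans (mono-suc x (m ℕ.+ p) (m ℕ.+ i)) (mono-+ x m p i)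

mono-* : ∀ c x m k → mono (c * x) m k ≡ c * mono x m k
mono-* c x m k with k ≟ m
... | yes _ = refl
... | no  _ = sym (ℚP.*-zeroʳ c)

mono-⊛ : ∀ x m (f : Series) k → (mono x m ⊛ f) k ≡ x * shift m f k
mono-⊛ x zero    f k       = begin
  (mono x 0 ⊛ f) k                                       ≡⟨ ⊛-sumBelow (mono x 0) f k ⟩
  x * f (k ∸ 0) + sumBelow k (λ i → 0ℚ * f (k ∸ suc i))
    ≡⟨ cong (x * f k +_) (sumBelow-zero k λ {i} _ → ℚP.*-zeroˡ (f (k ∸ suc i))) ⟩
  x * f k + 0ℚ                                           ≡⟨ ℚP.+-identityʳ _ ⟩
  x * f k                                                ∎
mono-⊛ x (suc m) f zero    = trans (⊛-zero (mono x (suc m)) f refl) (sym (ℚP.*-zeroʳ x))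
mono-⊛ x (suc m) f (suc k) = begin
  (mono x (suc m) ⊛ f) (suc k)  ≡⟨ ⊛-suc (mono x (suc m)) f refl k ⟩
  ((mono x (suc m) ∘ suc) ⊛ f) k ≡⟨ ⊛-congˡ f (mono-suc x m) k ⟩
  (mono x m ⊛ f) k               ≡⟨ mono-⊛ x m f k ⟩
  x * shift m f k                ∎

data Offset (m : ℕ) : ℕ → Set where
  before : ∀ {k} → k < m → Offset m k
  after  : ∀ i → Offset m (m ℕ.+ i)

offset : ∀ m k → Offset m k
offset zero    k       = after k
offset (suc m) zero    = before (s≤s z≤n)
offset (suc m) (suc k) with offset m k
... | before k<m = before (s≤s k<m)
... | after i    = after i

geom-extend : ∀ a m .{{_ : ℕ.NonZero m}} {i N} → i < N →
              sumBelow N (λ j → mono (pow a j) (m ℕ.* j) i) ≡ geom a m i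
geom-extend a m {i} i<N with ℕP.m≤n⇒∃[o]m+o≡n i<N
... | r , refl = begin
  sumBelow (suc i ℕ.+ r) h                                ≡⟨ sumBelow-+ (suc i) r h ⟩
  sumBelow (suc i) h + sumBelow r (λ j → h (suc i ℕ.+ j))  ≡⟨ cong (sumBelow (suc i) h +_) (sumBelow-zero r beyond) ⟩
  sumBelow (suc i) h + 0ℚ                                 ≡⟨ ℚP.+-identityʳ _ ⟩
  sumBelow (suc i) h                                      ≡⟨ sumℚ-map-upTo h (suc i) ⟨
  geom a m i                                              ∎
  where
  h : ℕ → ℚ
  h j = mono (pow a j) (m ℕ.* j) i
  beyond : ∀ {j} → j < r → h (suc i ℕ.+ j) ≡ 0ℚ
  beyond {j} _ = mono-≢ _ (ℕP.<⇒≢ (ℕP.<-≤-trans (ℕP.m≤m+n (suc i) j) (ℕP.m≤n*m (suc i ℕ.+ j) m)))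

geom-unfold : ∀ a m .{{_ : ℕ.NonZero m}} k → geom a m k ≡ mono 1ℚ 0 k + a * shift m (geom a m) k
geom-unfold a m k = begin
  geom a m k
    ≡⟨ sumℚ-map-upTo (λ j → mono (pow a j) (m ℕ.* j) k) (suc k) ⟩
  mono 1ℚ (m ℕ.* 0) k + sumBelow k (λ j → mono (a * pow a j) (m ℕ.* suc j) k)
    ≡⟨ cong₂ _+_ (cong (λ p → mono 1ℚ p k) (ℕP.*-zeroʳ m)) (tail (offset m k)) ⟩
  mono 1ℚ 0 k + a * shift m (geom a m) k ∎
  where
  term : ∀ j i → mono (a * pow a j) (m ℕ.* suc j) (m ℕ.+ i) ≡ a * mono (pow a j) (m ℕ.* j) i
  term j i = begin
    mono (a * pow a j) (m ℕ.* suc j) (m ℕ.+ i)      ≡⟨ cong (λ p → mono (a * pow a j) p (m ℕ.+ i)) (ℕP.*-suc m j) ⟩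
    mono (a * pow a j) (m ℕ.+ m ℕ.* j) (m ℕ.+ i)    ≡⟨ mono-+ (a * pow a j) m (m ℕ.* j) i ⟩
    mono (a * pow a j) (m ℕ.* j) i                  ≡⟨ mono-* a (pow a j) (m ℕ.* j) i ⟩
    a * mono (pow a j) (m ℕ.* j) i                  ∎
  tail : ∀ {k} → Offset m k → sumBelow k (λ j → mono (a * pow a j) (m ℕ.* suc j) k) ≡ a * shift m (geom a m) k
  tail (before {k} k<m) = begin
    sumBelow k (λ j → mono (a * pow a j) (m ℕ.* suc j) k)
      ≡⟨ sumBelow-zero k (λ {j} _ → mono-≢ _ (ℕP.<⇒≢ (ℕP.<-≤-trans k<m (ℕP.m≤m*n m (suc j))))) ⟩
    0ℚ                              ≡⟨ ℚP.*-zeroʳ a ⟨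
    a * 0ℚ                          ≡⟨ cong (a *_) (shift-< (geom a m) k<m) ⟨
    a * shift m (geom a m) k        ∎
  tail (after i) = begin
    sumBelow (m ℕ.+ i) (λ j → mono (a * pow a j) (m ℕ.* suc j) (m ℕ.+ i))
      ≡⟨ sumBelow-cong (m ℕ.+ i) (λ {j} _ → term j i) ⟩
    sumBelow (m ℕ.+ i) (λ j → a * mono (pow a j) (m ℕ.* j) i)
      ≡⟨ *-distribˡ-sumBelow a (m ℕ.+ i) (λ j → mono (pow a j) (m ℕ.* j) i) ⟨
    a * sumBelow (m ℕ.+ i) (λ j → mono (pow a j) (m ℕ.* j) i)
      ≡⟨ cong (a *_) (geom-extend a m (ℕP.m<n+m i (ℕ.>-nonZero⁻¹ m))) ⟩
    a * geom a m i
      ≡⟨ cong (a *_) (shift-+ m (geom a m) i) ⟨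
    a * shift m (geom a m) (m ℕ.+ i) ∎

-- S solves (1 - a T^m) S = B, where shift m is multiplication by T^m.
Solves : ℚ → ℕ → Series → Series → Set
Solves a m B S = ∀ k → S k ≡ B k + a * shift m S k

Solves-unique : ∀ {a m B S S'} → Solves a (suc m) B S → Solves a (suc m) B S' → ∀ k → S k ≡ S' k
Solves-unique {a} {m} {B} {S} {S'} solS solS' = <-rec (λ k → S k ≡ S' k) λ k IH → begin
  S k                           ≡⟨ solS k ⟩
  B k + a * shift (suc m) S k   ≡⟨ cong (λ x → B k + a * x) (shift-suc-cong-< m IH) ⟩
  B k + a * shift (suc m) S' k  ≡⟨ solS' k ⟨
  S' k                          ∎

geom-⊛-solves : ∀ a m .{{_ : ℕ.NonZero m}} B → Solves a m B (geom a m ⊛ B)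
geom-⊛-solves a m B k = begin
  (geom a m ⊛ B) k
    ≡⟨ ⊛-congˡ B (geom-unfold a m) k ⟩
  ((λ i → mono 1ℚ 0 i + (a ·ₛ shift m (geom a m)) i) ⊛ B) k
    ≡⟨ ⊛-distribʳ-+ (mono 1ℚ 0) (a ·ₛ shift m (geom a m)) B k ⟩
  (mono 1ℚ 0 ⊛ B) k + ((a ·ₛ shift m (geom a m)) ⊛ B) k
    ≡⟨ cong₂ _+_ (trans (mono-⊛ 1ℚ 0 B k) (ℚP.*-identityˡ (B k))) (⊛-·ₛˡ a (shift m (geom a m)) B k) ⟩
  B k + a * (shift m (geom a m) ⊛ B) k
    ≡⟨ cong (λ x → B k + a * x) (shift-⊛ m (geom a m) B k) ⟩
  B k + a * shift m (geom a m ⊛ B) k ∎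

geom-⊛-solution : ∀ a m B {S} → Solves a (suc m) B S → ∀ k → (geom a (suc m) ⊛ B) k ≡ S k
geom-⊛-solution a m B = Solves-unique {a} {m} {B} (geom-⊛-solves a (suc m) B)

sumVecs : (n k : ℕ) → (Vec ℕ n → ℚ) → ℚ
sumVecs n k f = sumℚ (map f (vecsWithSum n k))

sumVecs-suc : ∀ n k (f : Vec ℕ (suc n) → ℚ) →
              sumVecs (suc n) k f ≡ sumBelow (suc k) (λ i → sumVecs n (k ∸ i) (f ∘ (i ∷_)))
sumVecs-suc n k f = begin
  sumVecs (suc n) k f
    ≡⟨ sumℚ-concatMap f (λ i → map (i ∷_) (vecsWithSum n (k ∸ i))) (List.upTo (suc k)) ⟩
  sumℚ (map (λ i → sumℚ (map f (map (i ∷_) (vecsWithSum n (k ∸ i))))) (List.upTo (suc k)))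
    ≡⟨ cong sumℚ (List.map-cong (λ i → cong sumℚ (List.map-∘ (vecsWithSum n (k ∸ i)))) (List.upTo (suc k))) ⟨
  sumℚ (map (λ i → sumVecs n (k ∸ i) (f ∘ (i ∷_))) (List.upTo (suc k)))
    ≡⟨ sumℚ-map-upTo (λ i → sumVecs n (k ∸ i) (f ∘ (i ∷_))) (suc k) ⟩
  sumBelow (suc k) (λ i → sumVecs n (k ∸ i) (f ∘ (i ∷_))) ∎

size-vecsWithSum : ∀ n k → All (λ w → size w ≡ k) (vecsWithSum n k)
size-vecsWithSum zero    zero    = refl ∷ []
size-vecsWithSum zero    (suc k) = []
size-vecsWithSum (suc n) k       = concat⁺ (map⁺ (applyUpTo⁺₁ id (suc k) λ {i} i≤k →
  map⁺ (All.map (λ {w} size≡ → trans (cong (i ℕ.+_) size≡) (ℕP.m+[n∸m]≡n (ℕP.≤-pred i≤k))) (size-vecsWithSum n (k ∸ i)))))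

-- Adding 1 to every coordinate is a bijection from vectors of size j onto
-- positive vectors of size n + j.
sumVecs-positive : ∀ n k (f : Vec ℕ n → ℚ) →
  sumℚ (map f (filter (allV? (1 ≤?_)) (vecsWithSum n k))) ≡ shift n (λ j → sumVecs n j (f ∘ Vec.map suc)) k
sumVecs-positive n k f = trans (sumℚ-filter (allV? (1 ≤?_)) f (vecsWithSum n k)) (restricted n k f)
  where
  restricted : ∀ n k (f : Vec ℕ n → ℚ) →
    sumVecs n k (λ w → if does (allV? (1 ≤?_) w) then f w else 0ℚ) ≡ shift n (λ j → sumVecs n j (f ∘ Vec.map suc)) k
  restricted zero    zero    f = refl
  restricted zero    (suc k) f = refl
  restricted (suc n) zero    f = begin
    sumVecs (suc n) 0 (λ w → if does (allV? (1 ≤?_) w) then f w else 0ℚ)  ≡⟨ sumVecs-suc n 0 _ ⟩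
    sumVecs n 0 (λ _ → 0ℚ) + 0ℚ                                            ≡⟨ ℚP.+-identityʳ _ ⟩
    sumVecs n 0 (λ _ → 0ℚ)                                                 ≡⟨ sumℚ-zeros (vecsWithSum n 0) ⟩
    0ℚ                                                                    ∎
  restricted (suc n) (suc k) f = begin
    sumVecs (suc n) (suc k) (λ w → if does (allV? (1 ≤?_) w) then f w else 0ℚ)
      ≡⟨ sumVecs-suc n (suc k) _ ⟩
    sumVecs n (suc k) (λ _ → 0ℚ)
      + sumBelow (suc k) (λ i → sumVecs n (k ∸ i) (λ w → if does (allV? (1 ≤?_) w) then f (suc i ∷ w) else 0ℚ))
      ≡⟨ cong₂ _+_ (sumℚ-zeros (vecsWithSum n (suc k)))
                   (sumBelow-cong (suc k) λ {i} _ → restricted n (k ∸ i) (f ∘ (suc i ∷_))) ⟩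
    0ℚ + sumBelow (suc k) (λ i → shift n (F i) (k ∸ i))
      ≡⟨ ℚP.+-identityˡ _ ⟩
    sumBelow (suc k) (λ i → shift n (F i) (k ∸ i))
      ≡⟨ sumBelow-shift n k F ⟩
    shift n (λ j → sumBelow (suc j) (λ i → F i (j ∸ i))) k
      ≡⟨ shift-cong n (λ j → sumVecs-suc n j (f ∘ Vec.map suc)) k ⟨
    shift n (λ j → sumVecs (suc n) j (f ∘ Vec.map suc)) k ∎
    where
    F : ℕ → Series
    F i j = sumVecs n j (λ w → f (suc i ∷ Vec.map suc w))

All≤⇔≤minV : ∀ {n m} (w : Vec ℕ (suc n)) → AllV (m ≤_) w ⇔ m ≤ minV w
All≤⇔≤minV w = mk⇔ (to w) (from w)
  where
  to : ∀ {n m} (w : Vec ℕ (suc n)) → AllV (m ≤_) w → m ≤ minV w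
  to (x ∷ [])    (m≤x ∷ [])  = m≤x
  to (x ∷ y ∷ w) (m≤x ∷ m≤w) = ℕP.⊓-glb m≤x (to (y ∷ w) m≤w)
  from : ∀ {n m} (w : Vec ℕ (suc n)) → m ≤ minV w → AllV (m ≤_) w
  from (x ∷ [])    m≤x = m≤x ∷ []
  from (x ∷ y ∷ w) m≤min =
    ℕP.≤-trans m≤min (ℕP.m⊓n≤m x _) ∷ from (y ∷ w) (ℕP.≤-trans m≤min (ℕP.m⊓n≤n x _))

minV≡0≐nonPositive : ∀ {n} → (λ (w : Vec ℕ (suc n)) → minV w ≡ 0) ≐ ∁ (AllV (1 ≤_))
minV≡0≐nonPositive = (λ {w} min≡0 positive → ℕP.n≮0 (subst (1 ≤_) min≡0 (Equivalence.to (All≤⇔≤minV w) positive)))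
                   , (λ {w} ¬positive → ℕP.n<1⇒n≡0 (ℕP.≰⇒> (¬positive ∘ Equivalence.from (All≤⇔≤minV w))))

∈-allSubsets : ∀ {n} (B : Subset n) → B ∈ₗ allSubsets n
∈-allSubsets []                = hereₗ refl
∈-allSubsets {suc n} (inside ∷ B)  = ∈-++⁺ˡ (∈-map⁺ (inside ∷_) (∈-allSubsets B))
∈-allSubsets {suc n} (outside ∷ B) = ∈-++⁺ʳ (map (inside ∷_) (allSubsets n)) (∈-map⁺ (outside ∷_) (∈-allSubsets B))

∣p∪⁅y⁆∣≡1+∣p∣ : ∀ {n} (p : Subset n) {y} → y ∉ p → ∣ p ∪ ⁅ y ⁆ ∣ ≡ suc ∣ p ∣
∣p∪⁅y⁆∣≡1+∣p∣ (inside  ∷ p) {fzero} y∉p = contradiction here y∉p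
∣p∪⁅y⁆∣≡1+∣p∣ (outside ∷ p) {fzero} _   = cong (suc ∘ ∣_∣) (∪-identityʳ p)
∣p∪⁅y⁆∣≡1+∣p∣ (inside  ∷ p) {fsuc y} y∉p = cong suc (∣p∪⁅y⁆∣≡1+∣p∣ p (y∉p ∘ there))
∣p∪⁅y⁆∣≡1+∣p∣ (outside ∷ p) {fsuc y} y∉p = ∣p∪⁅y⁆∣≡1+∣p∣ p (y∉p ∘ there)

1+∣p-x∣≡∣p∣ : ∀ {n} (p : Subset n) {x} → x ∈ p → suc ∣ p ∖ x ∣ ≡ ∣ p ∣
1+∣p-x∣≡∣p∣ (inside  ∷ p) here        = cong (suc ∘ ∣_∣) (p─⊥≡p p)
1+∣p-x∣≡∣p∣ (inside  ∷ p) (there x∈p) = cong suc (1+∣p-x∣≡∣p∣ p x∈p)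
1+∣p-x∣≡∣p∣ (outside ∷ p) (there x∈p) = 1+∣p-x∣≡∣p∣ p x∈p

∣p-x∪⁅y⁆∣≡∣p∣ : ∀ {n} (p : Subset n) {x y} → x ∈ p → y ∉ p → ∣ (p ∖ x) ∪ ⁅ y ⁆ ∣ ≡ ∣ p ∣
∣p-x∪⁅y⁆∣≡∣p∣ p {x} x∈p y∉p = trans (∣p∪⁅y⁆∣≡1+∣p∣ (p ∖ x) (y∉p ∘ p─q⊆p p ⁅ x ⁆)) (1+∣p-x∣≡∣p∣ p x∈p)

x∈p─q⇒x∉q : ∀ {n} (p q : Subset n) {x} → x ∈ p ─ q → x ∉ q
x∈p─q⇒x∉q (inside ∷ p) (outside ∷ q) here         ()
x∈p─q⇒x∉q (s      ∷ p) (t       ∷ q) (there x∈p─q) (there x∈q) = x∈p─q⇒x∉q p q x∈p─q x∈q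

p∪⁅y⁆─q≡p─q : ∀ {n} (p : Subset n) {q y} → y ∈ q → (p ∪ ⁅ y ⁆) ─ q ≡ p ─ q
p∪⁅y⁆─q≡p─q (s       ∷ p) {inside ∷ q} here        = cong (λ r → outside ∷ (r ─ q)) (∪-identityʳ p)
p∪⁅y⁆─q≡p─q (inside  ∷ p) {t ∷ q}      (there y∈q) = cong₂ _∷_ refl (p∪⁅y⁆─q≡p─q p y∈q)
p∪⁅y⁆─q≡p─q (outside ∷ p) {t ∷ q}      (there y∈q) = cong₂ _∷_ refl (p∪⁅y⁆─q≡p─q p y∈q)

∣p-x∪⁅y⁆─q∣<∣p─q∣ : ∀ {n} (p q : Subset n) {x y} → x ∈ p → x ∉ q → y ∈ q →
                    ∣ ((p ∖ x) ∪ ⁅ y ⁆) ─ q ∣ < ∣ p ─ q ∣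
∣p-x∪⁅y⁆─q∣<∣p─q∣ p q {x} x∈p x∉q y∈q =
  subst (_< ∣ p ─ q ∣) (sym (trans (cong ∣_∣ (p∪⁅y⁆─q≡p─q (p ∖ x) y∈q)) (cong ∣_∣ (p─q─r≡p─r─q p ⁅ x ⁆ q))))
        (x∈p⇒∣p-x∣<∣p∣ (x∈p∧x∉q⇒x∈p─q x∈p x∉q))

weight-map-suc : ∀ {n} (B : Subset n) (w : Vec ℕ n) → weight B (Vec.map suc w) ≡ weight B w ℕ.+ ∣ B ∣
weight-map-suc []            []      = refl
weight-map-suc (inside  ∷ B) (x ∷ w) = begin
  suc (x ℕ.+ weight B (Vec.map suc w))     ≡⟨ cong (λ t → suc (x ℕ.+ t)) (weight-map-suc B w) ⟩
  suc (x ℕ.+ (weight B w ℕ.+ ∣ B ∣))        ≡⟨ cong suc (ℕP.+-assoc x (weight B w) ∣ B ∣) ⟨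
  suc (x ℕ.+ weight B w ℕ.+ ∣ B ∣)          ≡⟨ ℕP.+-suc (x ℕ.+ weight B w) ∣ B ∣ ⟨
  x ℕ.+ weight B w ℕ.+ suc ∣ B ∣            ∎
weight-map-suc (outside ∷ B) (x ∷ w) = weight-map-suc B w

module _ {n : ℕ} (M : Matroid n) where
  open Matroid M

  -- Exchange elements of B₁ ─ B₂ for elements of B₂ until B₁ ⊆ B₂.
  ∣basis∣≤∣basis∣ : ∀ {B₁ B₂} → Acc _<_ ∣ B₁ ─ B₂ ∣ → Basis B₁ → Basis B₂ → ∣ B₁ ∣ ≤ ∣ B₂ ∣
  ∣basis∣≤∣basis∣ {B₁} {B₂} (acc rec) b₁ b₂ with nonempty? (B₁ ─ B₂)
  ... | no B₁─B₂-empty = p⊆q⇒∣p∣≤∣q∣ λ {x} x∈B₁ →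
        decidable-stable (x ∈? B₂) (λ x∉B₂ → B₁─B₂-empty (x , x∈p∧x∉q⇒x∈p─q x∈B₁ x∉B₂))
  ... | yes (x , x∈B₁─B₂) = exchange-step (exchange b₁ b₂ x∈B₁ x∉B₂)
    where
    x∈B₁ : x ∈ B₁
    x∈B₁ = p─q⊆p B₁ B₂ x∈B₁─B₂
    x∉B₂ : x ∉ B₂
    x∉B₂ = x∈p─q⇒x∉q B₁ B₂ x∈B₁─B₂
    exchange-step : ∃ (λ y → y ∈ B₂ × y ∉ B₁ × Basis ((B₁ ∖ x) ∪ ⁅ y ⁆)) → ∣ B₁ ∣ ≤ ∣ B₂ ∣
    exchange-step (y , y∈B₂ , y∉B₁ , b₁′) =
      subst (_≤ ∣ B₂ ∣) (∣p-x∪⁅y⁆∣≡∣p∣ B₁ x∈B₁ y∉B₁)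
            (∣basis∣≤∣basis∣ (rec (∣p-x∪⁅y⁆─q∣<∣p─q∣ B₁ B₂ x∈B₁ x∉B₂ y∈B₂)) b₁′ b₂)

  ∣basis∣≡∣basis∣ : ∀ {B₁ B₂} → Basis B₁ → Basis B₂ → ∣ B₁ ∣ ≡ ∣ B₂ ∣
  ∣basis∣≡∣basis∣ b₁ b₂ =
    ℕP.≤-antisym (∣basis∣≤∣basis∣ (<-wellFounded _) b₁ b₂) (∣basis∣≤∣basis∣ (<-wellFounded _) b₂ b₁)

  basis⇒∈bases : ∀ {B} → Basis B → B ∈ₗ bases M
  basis⇒∈bases {B} b = ∈-filter⁺ basis? (∈-allSubsets B) b

  bases-are-bases : All Basis (bases M)
  bases-are-bases = all-filter basis? (allSubsets n)

  ∣basis∣≡rk : ∀ {B} → Basis B → ∣ B ∣ ≡ rk M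
  ∣basis∣≡rk b = sym (maxℕ-map-const (basis⇒∈bases b)
    (All.map (λ {B′} b′ → trans (cong ∣_∣ (∩-identityˡ B′)) (∣basis∣≡∣basis∣ b′ b)) bases-are-bases))

  weight-map-suc-basis : ∀ {B} → Basis B → ∀ w → weight B (Vec.map suc w) ≡ weight B w ℕ.+ rk M
  weight-map-suc-basis {B} b w = trans (weight-map-suc B w) (cong (weight B w ℕ.+_) (∣basis∣≡rk b))

  wt-map-suc : ∀ w → wt M (Vec.map suc w) ≡ wt M w ℕ.+ rk M
  wt-map-suc w = trans (cong maxℕ (List.map-cong-local (All.map (λ b → weight-map-suc-basis b w) bases-are-bases)))
                       (maxℕ-map-+ (λ B → weight B w) (rk M) (basis⇒∈bases (proj₂ nonempty)))

  basesAt-map-suc : ∀ w → basesAt M (Vec.map suc w) ≡ basesAt M w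
  basesAt-map-suc w = filter-cong-local _ _ (All.map maximal⇔maximal bases-are-bases)
    where
    maximal⇔maximal : ∀ {B} → Basis B → (weight B (Vec.map suc w) ≡ wt M (Vec.map suc w)) ⇔ (weight B w ≡ wt M w)
    maximal⇔maximal {B} b rewrite weight-map-suc-basis b w | wt-map-suc w =
      mk⇔ (ℕP.+-cancelʳ-≡ (rk M) (weight B w) (wt M w)) (cong (ℕ._+ rk M))

pow-+ : ∀ x m k → pow x (m ℕ.+ k) ≡ pow x m * pow x k
pow-+ x zero    k = sym (ℚP.*-identityˡ _)
pow-+ x (suc m) k = trans (cong (x *_) (pow-+ x m k)) (sym (ℚP.*-assoc x _ _))

*-cancel-1/ : ∀ q .{{_ : ℚ.NonZero q}} x → q * (1/ q * x) ≡ x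
*-cancel-1/ q x = begin
  q * (1/ q * x)   ≡⟨ ℚP.*-assoc q (1/ q) x ⟨
  q * 1/ q * x     ≡⟨ cong (_* x) (ℚP.*-inverseʳ q) ⟩
  1ℚ * x           ≡⟨ ℚP.*-identityˡ x ⟩
  x                ∎

powℤ-1-N : ∀ q .{{_ : ℚ.NonZero q}} N → powℤ q (ℤ.+ 1 ℤ.- ℤ.+ N) ≡ q * pow (1/ q) N
powℤ-1-N q zero          = refl
powℤ-1-N q (suc zero)    = sym (*-cancel-1/ q 1ℚ)
powℤ-1-N q (suc (suc N)) = sym (*-cancel-1/ q (pow (1/ q) (suc N)))

*-cancel-÷ : ∀ q d .{{_ : ℚ.NonZero q}} .{{_ : ℚ.NonZero d}} x p → (1/ q * d) * (x ÷ d * (q * p)) ≡ x * p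
*-cancel-÷ q d x p = begin
  (1/ q * d) * (x * 1/ d * (q * p))
    ≡⟨ solve 6 (λ iq Q D iD X P → (iq :* D) :* ((X :* iD) :* (Q :* P)) := (Q :* iq) :* (D :* iD) :* (X :* P)) refl
         (1/ q) q d (1/ d) x p ⟩
  (q * 1/ q) * (d * 1/ d) * (x * p)
    ≡⟨ cong₂ (λ s t → s * t * (x * p)) (ℚP.*-inverseʳ q) (ℚP.*-inverseʳ d) ⟩
  1ℚ * 1ℚ * (x * p)
    ≡⟨ ℚP.*-identityˡ (x * p) ⟩
  x * p ∎
  where open +-*-Solver

exponent-identity : ∀ r w → ℤ.- (r ℤ.- 1ℤ) ℤ.- (w ℤ.- 0ℤ) ≡ 1ℤ ℤ.- (r ℤ.+ w)
exponent-identity = solve-∀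

module _ {n : ℕ} (M : Matroid n) (q : ℚ) .{{_ : ℚ.NonZero q}} where

  Zterm-map-suc : ∀ w → Zterm M q (Vec.map suc w) ≡ pow (1/ q) (rk M) * Zterm M q w
  Zterm-map-suc w = begin
    χ M (basesAt M (Vec.map suc w)) q * pow (1/ q) (rk M ℕ.+ wt M (Vec.map suc w))
      ≡⟨ cong₂ (λ L e → χ M L q * pow (1/ q) (rk M ℕ.+ e)) (basesAt-map-suc M w)
               (trans (wt-map-suc M w) (ℕP.+-comm (wt M w) (rk M))) ⟩
    χ M (basesAt M w) q * pow (1/ q) (rk M ℕ.+ (rk M ℕ.+ wt M w))
      ≡⟨ cong (χ M (basesAt M w) q *_) (pow-+ (1/ q) (rk M) (rk M ℕ.+ wt M w)) ⟩
    χ M (basesAt M w) q * (pow (1/ q) (rk M) * pow (1/ q) (rk M ℕ.+ wt M w))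
      ≡⟨ x*yz≡y*xz (χ M (basesAt M w) q) (pow (1/ q) (rk M)) (pow (1/ q) (rk M ℕ.+ wt M w)) ⟩
    pow (1/ q) (rk M) * Zterm M q w ∎

  Z⁰≡shift : ∀ k → Z⁰ M q k ≡ pow (1/ q) (rk M) * shift n (Z M q) k
  Z⁰≡shift k = begin
    Z⁰ M q k
      ≡⟨ sumVecs-positive n k (Zterm M q) ⟩
    shift n (λ j → sumVecs n j (Zterm M q ∘ Vec.map suc)) k
      ≡⟨ shift-cong n (λ j → trans (cong sumℚ (List.map-cong Zterm-map-suc (vecsWithSum n j)))
                                   (sym (*-distribˡ-sumℚ a (Zterm M q) (vecsWithSum n j)))) k ⟩
    shift n (a ·ₛ Z M q) k
      ≡⟨ shift-·ₛ n a (Z M q) k ⟩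
    a * shift n (Z M q) k ∎
    where
    a : ℚ
    a = pow (1/ q) (rk M)

  module _ .{{_ : ℚ.NonZero (q - 1ℚ)}} where

    Zbar-term : Vec ℕ n → ℚ
    Zbar-term w = χbar M (basesAt M w) q * powℤ q (ℤ.- (ℤ.+ rk M ℤ.- ℤ.+ 1) ℤ.- wtbar M q w)

    Zbar-term-minV≡0 : ∀ {w} → minV w ≡ 0 → (1/ q * (q - 1ℚ)) * Zbar-term w ≡ Zterm M q w
    Zbar-term-minV≡0 {w} minV≡0 = begin
      (1/ q * (q - 1ℚ)) * (χbar M (basesAt M w) q * powℤ q (ℤ.- (ℤ.+ rk M ℤ.- ℤ.+ 1) ℤ.- wtbar M q w))
        ≡⟨ cong (λ e → (1/ q * (q - 1ℚ)) * (χbar M (basesAt M w) q * powℤ q e)) exponent ⟩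
      (1/ q * (q - 1ℚ)) * (χbar M (basesAt M w) q * powℤ q (ℤ.+ 1 ℤ.- ℤ.+ (rk M ℕ.+ wt M w)))
        ≡⟨ cong (λ x → (1/ q * (q - 1ℚ)) * (χbar M (basesAt M w) q * x)) (powℤ-1-N q (rk M ℕ.+ wt M w)) ⟩
      (1/ q * (q - 1ℚ)) * (χbar M (basesAt M w) q * (q * pow (1/ q) (rk M ℕ.+ wt M w)))
        ≡⟨ *-cancel-÷ q (q - 1ℚ) (χ M (basesAt M w) q) (pow (1/ q) (rk M ℕ.+ wt M w)) ⟩
      Zterm M q w ∎
      where
      exponent : ℤ.- (ℤ.+ rk M ℤ.- ℤ.+ 1) ℤ.- wtbar M q w ≡ ℤ.+ 1 ℤ.- ℤ.+ (rk M ℕ.+ wt M w)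
      exponent rewrite minV≡0 | ℕP.*-zeroʳ (rk M) = exponent-identity (ℤ.+ rk M) (ℤ.+ wt M w)

module _ {n : ℕ} (M : Matroid (suc n)) (q : ℚ) .{{_ : ℚ.NonZero q}} .{{_ : ℚ.NonZero (q - 1ℚ)}} where

  Z≡Zbar+Z⁰ : ∀ k → Z M q k ≡ (1/ q * (q - 1ℚ)) * Zbar M q k + Z⁰ M q k
  Z≡Zbar+Z⁰ k = begin
    Z M q k
      ≡⟨ sumℚ-filter-partition positive? (Zterm M q) V ⟨
    Z⁰ M q k + sumℚ (map (Zterm M q) (filter (∁? positive?) V))
      ≡⟨ ℚP.+-comm (Z⁰ M q k) _ ⟩
    sumℚ (map (Zterm M q) (filter (∁? positive?) V)) + Z⁰ M q k
      ≡⟨ cong (_+ Z⁰ M q k) cZbar≡ ⟨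
    c * Zbar M q k + Z⁰ M q k ∎
    where
    c : ℚ
    c = 1/ q * (q - 1ℚ)
    V : List (Vec ℕ (suc n))
    V = vecsWithSum (suc n) k
    positive? : Decidable (AllV (1 ≤_))
    positive? = allV? (1 ≤?_)
    minV≟0 : Decidable (λ (w : Vec ℕ (suc n)) → minV w ≡ 0)
    minV≟0 w = minV w ≟ 0
    sizebar≡k : All (λ w → sizebar M q w ≡ k) (filter minV≟0 V)
    sizebar≡k = All.zipWith (λ { {w} (minV≡0 , size≡k) → begin
        size w ∸ suc n ℕ.* minV w  ≡⟨ cong (λ m → size w ∸ suc n ℕ.* m) minV≡0 ⟩
        size w ∸ suc n ℕ.* 0       ≡⟨ cong (size w ∸_) (ℕP.*-zeroʳ (suc n)) ⟩
        size w                     ≡⟨ size≡k ⟩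
        k                          ∎ })
      (all-filter minV≟0 V , filter⁺ minV≟0 (size-vecsWithSum (suc n) k))
    cZbar≡ : c * Zbar M q k ≡ sumℚ (map (Zterm M q) (filter (∁? positive?) V))
    cZbar≡ = begin
      c * sumℚ (map (Zbar-term M q) (filter (λ w → sizebar M q w ≟ k) (filter minV≟0 V)))
        ≡⟨ cong (λ L → c * sumℚ (map (Zbar-term M q) L)) (List.filter-all (λ w → sizebar M q w ≟ k) sizebar≡k) ⟩
      c * sumℚ (map (Zbar-term M q) (filter minV≟0 V))
        ≡⟨ *-distribˡ-sumℚ c (Zbar-term M q) (filter minV≟0 V) ⟩
      sumℚ (map (λ w → c * Zbar-term M q w) (filter minV≟0 V))
        ≡⟨ cong sumℚ (List.map-cong-local (All.map (Zbar-term-minV≡0 M q) (all-filter minV≟0 V))) ⟩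
      sumℚ (map (Zterm M q) (filter minV≟0 V))
        ≡⟨ cong (λ L → sumℚ (map (Zterm M q) L)) (List.filter-≐ minV≟0 (∁? positive?) minV≡0≐nonPositive V) ⟩
      sumℚ (map (Zterm M q) (filter (∁? positive?) V)) ∎

  Z-solves : Solves (pow (1/ q) (rk M)) (suc n) ((1/ q * (q - 1ℚ)) ·ₛ Zbar M q) (Z M q)
  Z-solves k = trans (Z≡Zbar+Z⁰ k) (cong ((1/ q * (q - 1ℚ)) * Zbar M q k +_) (Z⁰≡shift M q k))

proposition3p1 : ∀ {n : ℕ} .{{_ : ℕ.NonZero n}} (M : Matroid n)
    (q : ℚ) .{{_ : ℚ.NonZero q}} .{{_ : ℚ.NonZero (q - 1ℚ)}} →
    (∀ k → Z M q k ≡ (((1/ q) * (q - 1ℚ)) ·ₛ (geom (pow (1/ q) (rk M)) n ⊛ Zbar M q)) k)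
    × (∀ k → Z⁰ M q k ≡ (((1/ q) * (q - 1ℚ)) ·ₛ ((mono (pow (1/ q) (rk M)) n ⊛ geom (pow (1/ q) (rk M)) n) ⊛ Zbar M q)) k)
proposition3p1 {suc n} M q = Z-formula , Z⁰-formula
  where
  c a : ℚ
  c = 1/ q * (q - 1ℚ)
  a = pow (1/ q) (rk M)
  g B : Series
  g = geom a (suc n)
  B = c ·ₛ Zbar M q
  g⊛B≡Z : ∀ k → (g ⊛ B) k ≡ Z M q k
  g⊛B≡Z = geom-⊛-solution a n B (Z-solves M q)
  Z-formula : ∀ k → Z M q k ≡ c * (g ⊛ Zbar M q) k
  Z-formula k = trans (sym (g⊛B≡Z k)) (⊛-·ₛʳ c g (Zbar M q) k)
  Z⁰-formula : ∀ k → Z⁰ M q k ≡ c * ((mono a (suc n) ⊛ g) ⊛ Zbar M q) k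
  Z⁰-formula k = begin
    Z⁰ M q k                               ≡⟨ Z⁰≡shift M q k ⟩
    a * shift (suc n) (Z M q) k            ≡⟨ cong (a *_) (shift-cong (suc n) g⊛B≡Z k) ⟨
    a * shift (suc n) (g ⊛ B) k            ≡⟨ cong (a *_) (shift-⊛ (suc n) g B k) ⟨
    a * (shift (suc n) g ⊛ B) k            ≡⟨ ⊛-·ₛˡ a (shift (suc n) g) B k ⟨
    ((a ·ₛ shift (suc n) g) ⊛ B) k         ≡⟨ ⊛-congˡ B (mono-⊛ a (suc n) g) k ⟨
    ((mono a (suc n) ⊛ g) ⊛ B) k           ≡⟨ ⊛-·ₛʳ c (mono a (suc n) ⊛ g) (Zbar M q) k ⟩
    c * ((mono a (suc n) ⊛ g) ⊛ Zbar M q) k ∎
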